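{- Let $k\ge 1$ and $n$ be positive integers. Suppose there exists a Steiner system $S(n,2k^2+1,2)$, i.e. a family of $(2k^2+1)$-element subsets of $[n]$ such that every $2$-element subset of $[n]$ is contained in exactly one member, and suppose there is a pair of disjoint $k$-element subsets of $\{1,\dots,2k^2+1\}$ that is antagonistic modulo $2k^2+1$. Then $$C(n,k,2k-1)=\frac{n(n-1)}{2k^2}.$$
   Context: For $a,b\in\{1,\dots,m\}$ let $\delta(a,b)=\min\{|b-a|,\ m-|b-a|\}$ (circular distance modulo $m$). Disjoint sets $S=\{s_1,\dots,s_k\}$, $T=\{t_1,\dots,t_k\}\subseteq\{1,\dots,m\}$ form an antagonistic pair modulo $m$ if (i) the $k(k-1)$ integers $\delta(s_i,s_j)$ ($i<j$) and $\delta(t_i,t_j)$ ($i<j$) are pairwise different; (ii) the $k^2$ integers $\delta(s_i,t_j)$ are pairwise different; (iii) $\delta(s_i,t_j)\ne m/2$ for all $i,j$. For $0<k\le n/2$, $\mathcal Y$ is the family of unordered pairs $\{A_1,A_2\}$ of disjoint $k$-subsets of $[n]$ with distance $d(\{A_1,A_2\},\{B_1,B_2\})=\min\{|A_1\setminus B_1|+|A_2\setminus B_2|,\ |A_1\setminus B_2|+|A_2\setminus B_1|\}$; $C(n,k,d)$ is the maximum size of a subfamily of $\mathcal Y$ any two distinct members of which have distance at least $d$. -}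

module Defs where

open import Data.Nat using (ℕ; _+_; _*_; _∸_; _⊓_; ∣_-_∣; _≤_; _<_)
open import Data.Fin using (Fin; toℕ)
open import Data.Fin.Subset using (Subset; _∈_; _∉_; _∩_; ∁; ∣_∣)
open import Data.Product using (Σ; _×_; ∃; ∃-syntax)
open import Relation.Binary.PropositionalEquality using (_≡_; _≢_)
open import Relation.Nullary using (¬_)

record SteinerSystem (n q : ℕ) : Set where
  field
    b          : ℕ
    block      : Fin b → Subset n
    blockSize  : ∀ i → ∣ block i ∣ ≡ q
    pairUnique : ∀ (x y : Fin n) → x ≢ y →
                 ∃[ i ] ((x ∈ block i × y ∈ block i) ×
                         (∀ j → x ∈ block j → y ∈ block j → j ≡ i))

-- Circular distance modulo m on residues (elements of {1..m} shifted to Fin m;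
-- differences are unaffected by the shift).

δ : (m : ℕ) → ℕ → ℕ → ℕ
δ m a b = ∣ a - b ∣ ⊓ (m ∸ ∣ a - b ∣)

δF : (m : ℕ) → Fin m → Fin m → ℕ
δF m a b = δ m (toℕ a) (toℕ b)

record AntagonisticPair (m k : ℕ) : Set where
  field
    s       : Fin k → Fin m
    t       : Fin k → Fin m
    s-inj   : ∀ i j → s i ≡ s j → i ≡ j
    t-inj   : ∀ i j → t i ≡ t j → i ≡ j
    disj    : ∀ i j → s i ≢ t j
    -- (i) the k(k-1) numbers δ(s_i,s_j), δ(t_i,t_j) (i<j) are pairwise different
    condSS  : ∀ i j i' j' → toℕ i < toℕ j → toℕ i' < toℕ j' →
              δF m (s i) (s j) ≡ δF m (s i') (s j') → (i ≡ i' × j ≡ j')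
    condTT  : ∀ i j i' j' → toℕ i < toℕ j → toℕ i' < toℕ j' →
              δF m (t i) (t j) ≡ δF m (t i') (t j') → (i ≡ i' × j ≡ j')
    condST  : ∀ i j i' j' → toℕ i < toℕ j → toℕ i' < toℕ j' →
              δF m (s i) (s j) ≢ δF m (t i') (t j')
    cond2   : ∀ i j i' j' →
              δF m (s i) (t j) ≡ δF m (s i') (t j') → (i ≡ i' × j ≡ j')
    -- (iii) δ(s_i,t_j) ≠ m/2   (stated as 2·δ ≠ m)
    cond3   : ∀ i j → 2 * δF m (s i) (t j) ≢ m

-- An unordered pair
-- is represented by either ordering; the distance below is symmetric under
-- swapping, and "same unordered pair" is expressed explicitly.

record KPair (n k : ℕ) : Set where
  constructor kpair
  field
    A₁    : Subset n
    A₂    : Subset n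
    size₁ : ∣ A₁ ∣ ≡ k
    size₂ : ∣ A₂ ∣ ≡ k
    disj  : ∀ x → x ∈ A₁ → x ∉ A₂
open KPair public

diff : ∀ {n} → Subset n → Subset n → ℕ
diff A B = ∣ A ∩ ∁ B ∣

dist : ∀ {n k} → KPair n k → KPair n k → ℕ
dist P Q = (diff (A₁ P) (A₁ Q) + diff (A₂ P) (A₂ Q))
         ⊓ (diff (A₁ P) (A₂ Q) + diff (A₂ P) (A₁ Q))

SameUnordered : ∀ {n k} → KPair n k → KPair n k → Set
SameUnordered P Q = (A₁ P ≡ A₁ Q × A₂ P ≡ A₂ Q) ⊎' (A₁ P ≡ A₂ Q × A₂ P ≡ A₁ Q)
  where
  open import Data.Sum using () renaming (_⊎_ to _⊎'_)

record Code (n k d M : ℕ) : Set where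
  field
    member   : Fin M → KPair n k
    distinct : ∀ i j → i ≢ j → ¬ SameUnordered (member i) (member j)
    minDist  : ∀ i j → i ≢ j → d ≤ dist (member i) (member j)

IsC : (n k d M : ℕ) → Set
IsC n k d M = Code n k d M × (∀ M' → Code n k d M' → M' ≤ M)

module Submission where

-- Upper bound: two members of a code of minimum distance 2k − 1 share at most one point in
-- aligned components (A₁ with A₁, A₂ with A₂) and at most one in crossed components.  So the
-- ordered pairs (x , y) with x ∈ A₁ and y ∈ A₂, taken for every member in both orientations, are
-- pairwise different, and M · 2k² ≤ n (n − 1).
--
-- Lower bound: with m = 2k² + 1, read every block of the Steiner system as ℤ_m and take the pairs
-- (S + x , T + x) for all blocks and all x ∈ ℤ_m.  Pairs from different blocks meet at most once.
-- In one block, a point common to S + x and S + y (or T + x and T + y) writes y − x as a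
-- difference within S or T, and a point common to S + x and T + y writes it as a difference
-- across S and T.  The antagonistic conditions say that each difference arises at most once,
-- up to sign; as m is odd no nonzero difference is its own negative, which also makes condition
-- (iii) superfluous.  Hence these b · m pairs form a code, and b · m · (m − 1) ≥ n (n − 1) by
-- sending each ordered pair of points to its block.

open import Data.Bool using (true)
open import Data.Empty using (⊥; ⊥-elim)
open import Data.Fin as Fin using (Fin; toℕ; punchIn; punchOut; remQuot)
open import Data.Fin.Properties as Finₚ using (_≟_; toℕ<n; *↔×; injective⇒≤)
open import Data.Fin.Subset using (Subset; _∈_; _∉_; _∩_; _∪_; ∁; ∣_∣; ⁅_⁆; inside; outside)
open import Data.Fin.Subset.Properties
  using (x∈p∩q⁺; x∈p∩q⁻; x∈p∪q⁻; ∩-idem; nonempty?; Empty-unique; ∣⊥∣≡0;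
         x∈⁅x⁆; x∈⁅y⁆⇒x≡y; ∣⁅x⁆∣≡1; p⊆q⇒∣p∣≤∣q∣)
open import Data.Nat
  using (ℕ; zero; suc; _+_; _*_; _∸_; _≤_; _<_; _⊓_; ∣_-_∣; z≤n; NonZero; >-nonZero; _≤?_; _%_)
open import Data.Nat.DivMod using (_mod_; m%n<n; [m+n]%n≡m%n; [m+kn]%n≡m%n; m<n⇒m%n≡m; %-distribˡ-+)
open import Data.Nat.Properties hiding (_≟_)
open import Algebra.Properties.CommutativeSemigroup +-commutativeSemigroup using (interchange)
open import Data.Nat.Solver using (module +-*-Solver)
open import Data.Product using (_×_; _,_; proj₁; proj₂; ∃; ∃-syntax; uncurry)
open import Data.Product.Function.NonDependent.Propositional using (_×-↔_)
open import Data.Product.Properties using (≡-dec)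
open import Data.Sum as Sum using (_⊎_; inj₁; inj₂)
open import Data.Vec using ([]; _∷_; tabulate)
open import Data.Vec.Base using (here; there)
open import Data.Vec.Properties using (lookup∘tabulate; []=⇒lookup; lookup⇒[]=)
open import Function using (_∘_; Injective; _↔_; _↣_; mk↣; Injection)
open import Function.Construct.Composition using (_↔-∘_; _↣-∘_)
open import Function.Construct.Identity using (↔-id)
open import Function.Construct.Symmetry using (↔-sym)
open import Function.Properties.Inverse using (↔⇒↣)
open import Relation.Binary.Definitions using (DecidableEquality; tri<; tri≈; tri>)
open import Relation.Binary.PropositionalEquality
open import Relation.Nullary using (¬_; Dec; yes; no; does)
open import Relation.Nullary.Decidable using (dec-true)

open import Defs

open +-*-Solver

private
  variable
    n k : ℕ

record Enumeration (p : Subset n) (k : ℕ) : Set where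
  field
    at           : Fin k → Fin n
    at-injective : Injective _≡_ _≡_ at
    at-∈         : ∀ a → at a ∈ p
    index        : ∀ {x} → x ∈ p → Fin k
    at-index     : ∀ {x} (x∈p : x ∈ p) → at (index x∈p) ≡ x

module _ {p : Subset n} (E : Enumeration p k) where
  open Enumeration E

  enumeration-outside : Enumeration (outside ∷ p) k
  enumeration-outside = record
    { at           = Fin.suc ∘ at
    ; at-injective = at-injective ∘ Finₚ.suc-injective
    ; at-∈         = there ∘ at-∈
    ; index        = λ { (there x∈p) → index x∈p }
    ; at-index     = λ { (there x∈p) → cong Fin.suc (at-index x∈p) }
    }

  enumeration-inside : Enumeration (inside ∷ p) (suc k)
  enumeration-inside = record
    { at = at′ ; at-injective = at′-injective ; at-∈ = at′-∈ ; index = index′ ; at-index = at′-index′ }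
    where
    at′ : Fin (suc k) → Fin (suc n)
    at′ Fin.zero    = Fin.zero
    at′ (Fin.suc a) = Fin.suc (at a)
    at′-injective : Injective _≡_ _≡_ at′
    at′-injective {Fin.zero}  {Fin.zero}  _  = refl
    at′-injective {Fin.suc a} {Fin.suc b} eq = cong Fin.suc (at-injective (Finₚ.suc-injective eq))
    at′-∈ : ∀ a → at′ a ∈ inside ∷ p
    at′-∈ Fin.zero    = here
    at′-∈ (Fin.suc a) = there (at-∈ a)
    index′ : ∀ {x} → x ∈ inside ∷ p → Fin (suc k)
    index′ here        = Fin.zero
    index′ (there x∈p) = Fin.suc (index x∈p)
    at′-index′ : ∀ {x} (x∈p : x ∈ inside ∷ p) → at′ (index′ x∈p) ≡ x
    at′-index′ here        = refl
    at′-index′ (there x∈p) = cong Fin.suc (at-index x∈p)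

enumerate : (p : Subset n) → Enumeration p ∣ p ∣
enumerate []            = record
  { at = λ () ; at-injective = λ {} ; at-∈ = λ () ; index = λ () ; at-index = λ () }
enumerate (outside ∷ p) = enumeration-outside (enumerate p)
enumerate (inside ∷ p)  = enumeration-inside (enumerate p)

enumerationOfSize : (p : Subset n) → ∣ p ∣ ≡ k → Enumeration p k
enumerationOfSize p refl = enumerate p

x∈p⇒1≤∣p∣ : ∀ {p : Subset n} {x} → x ∈ p → 1 ≤ ∣ p ∣
x∈p⇒1≤∣p∣ {x = x} x∈p = subst (_≤ _) (∣⁅x⁆∣≡1 x)
  (p⊆q⇒∣p∣≤∣q∣ λ y∈⁅x⁆ → subst (_∈ _) (sym (x∈⁅y⁆⇒x≡y x y∈⁅x⁆)) x∈p)

atMostOne⇒∣p∣≤1 : ∀ {p : Subset n} → (∀ {x y} → x ∈ p → y ∈ p → x ≡ y) → ∣ p ∣ ≤ 1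
atMostOne⇒∣p∣≤1 {n} {p} unique with nonempty? p
... | yes (x , x∈p) = subst (_ ≤_) (∣⁅x⁆∣≡1 x)
  (p⊆q⇒∣p∣≤∣q∣ λ y∈p → subst (_∈ ⁅ x ⁆) (unique x∈p y∈p) (x∈⁅x⁆ x))
... | no empty      = subst (λ q → ∣ q ∣ ≤ 1) (sym (Empty-unique empty)) (subst (_≤ 1) (sym (∣⊥∣≡0 n)) z≤n)

∣p∩∁q∣+∣p∩q∣≡∣p∣ : (p q : Subset n) → ∣ p ∩ ∁ q ∣ + ∣ p ∩ q ∣ ≡ ∣ p ∣
∣p∩∁q∣+∣p∩q∣≡∣p∣ []            []            = refl
∣p∩∁q∣+∣p∩q∣≡∣p∣ (inside ∷ p)  (inside ∷ q)  = trans (+-suc _ _) (cong suc (∣p∩∁q∣+∣p∩q∣≡∣p∣ p q))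
∣p∩∁q∣+∣p∩q∣≡∣p∣ (inside ∷ p)  (outside ∷ q) = cong suc (∣p∩∁q∣+∣p∩q∣≡∣p∣ p q)
∣p∩∁q∣+∣p∩q∣≡∣p∣ (outside ∷ p) (inside ∷ q)  = ∣p∩∁q∣+∣p∩q∣≡∣p∣ p q
∣p∩∁q∣+∣p∩q∣≡∣p∣ (outside ∷ p) (outside ∷ q) = ∣p∩∁q∣+∣p∩q∣≡∣p∣ p q

Disjoint : Subset n → Subset n → Set
Disjoint p q = ∀ {x} → x ∈ p → x ∉ q

disjoint-tail : ∀ {x y} {p q : Subset n} → Disjoint (x ∷ p) (y ∷ q) → Disjoint p q
disjoint-tail d x∈p x∈q = d (there x∈p) (there x∈q)

∣p∪q∣≡∣p∣+∣q∣ : (p q : Subset n) → Disjoint p q → ∣ p ∪ q ∣ ≡ ∣ p ∣ + ∣ q ∣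
∣p∪q∣≡∣p∣+∣q∣ []            []            _ = refl
∣p∪q∣≡∣p∣+∣q∣ (inside ∷ p)  (inside ∷ q)  d = ⊥-elim (d here here)
∣p∪q∣≡∣p∣+∣q∣ (inside ∷ p)  (outside ∷ q) d = cong suc (∣p∪q∣≡∣p∣+∣q∣ p q (disjoint-tail d))
∣p∪q∣≡∣p∣+∣q∣ (outside ∷ p) (inside ∷ q)  d =
  trans (cong suc (∣p∪q∣≡∣p∣+∣q∣ p q (disjoint-tail d))) (sym (+-suc _ _))
∣p∪q∣≡∣p∣+∣q∣ (outside ∷ p) (outside ∷ q) d = ∣p∪q∣≡∣p∣+∣q∣ p q (disjoint-tail d)

image : (Fin k → Fin n) → Subset n
image f = tabulate λ y → does (Finₚ.any? λ a → f a ≟ y)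

∈-image : (f : Fin k → Fin n) (a : Fin k) → f a ∈ image f
∈-image f a = lookup⇒[]= (f a) (image f)
  (trans (lookup∘tabulate _ (f a)) (dec-true (Finₚ.any? λ a′ → f a′ ≟ f a) (a , refl)))

image-preimage : (f : Fin k → Fin n) {y : Fin n} → y ∈ image f → ∃ λ a → f a ≡ y
image-preimage f {y} y∈img = witness (Finₚ.any? λ a → f a ≟ y)
  (trans (sym (lookup∘tabulate _ y)) ([]=⇒lookup y∈img))
  where
  witness : ∀ {A : Set} (d : Dec A) → does d ≡ true → A
  witness (yes a) _ = a

∣image∣≡k : (f : Fin k → Fin n) → Injective _≡_ _≡_ f → ∣ image f ∣ ≡ k
∣image∣≡k f f-injective = ≤-antisym (injective⇒≤ preimage-injective) (injective⇒≤ index-injective)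
  where
  open Enumeration (enumerate (image f))
  preimage : Fin ∣ image f ∣ → Fin _
  preimage c = proj₁ (image-preimage f (at-∈ c))
  preimage-injective : Injective _≡_ _≡_ preimage
  preimage-injective {c} {c′} eq = at-injective (begin
    at c                  ≡⟨ proj₂ (image-preimage f (at-∈ c)) ⟨
    f (preimage c)        ≡⟨ cong f eq ⟩
    f (preimage c′)       ≡⟨ proj₂ (image-preimage f (at-∈ c′)) ⟩
    at c′                 ∎)
    where open ≡-Reasoning
  index-injective : Injective _≡_ _≡_ (λ a → index (∈-image f a))
  index-injective {a} {a′} eq = f-injective (begin
    f a                        ≡⟨ at-index (∈-image f a) ⟨
    at (index (∈-image f a))   ≡⟨ cong at eq ⟩
    at (index (∈-image f a′))  ≡⟨ at-index (∈-image f a′) ⟩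
    f a′                       ∎)
    where open ≡-Reasoning

↣⇒≤ : ∀ {m} → Fin m ↣ Fin n → m ≤ n
↣⇒≤ f = injective⇒≤ (Injection.injective f)

punchOutPair : (x y : Fin n) → x ≢ y → Fin n × Fin (n ∸ 1)
punchOutPair {suc n} x y x≢y = x , punchOut x≢y

punchOutPair-injective : ∀ {x y x′ y′ : Fin n} (x≢y : x ≢ y) (x′≢y′ : x′ ≢ y′) →
                         punchOutPair x y x≢y ≡ punchOutPair x′ y′ x′≢y′ → x ≡ x′ × y ≡ y′
punchOutPair-injective {suc n} x≢y x′≢y′ eq with refl ← cong proj₁ eq =
  refl , Finₚ.punchOut-injective x≢y x′≢y′ (cong proj₂ eq)

swap : KPair n k → KPair n k
swap P = kpair (A₂ P) (A₁ P) (size₂ P) (size₁ P) λ x x∈A₂ x∈A₁ → disj P x x∈A₁ x∈A₂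

alignedDist : KPair n k → KPair n k → ℕ
alignedDist P Q = diff (A₁ P) (A₁ Q) + diff (A₂ P) (A₂ Q)

shared : KPair n k → KPair n k → ℕ
shared P Q = ∣ A₁ P ∩ A₁ Q ∣ + ∣ A₂ P ∩ A₂ Q ∣

common : KPair n k → KPair n k → Subset n
common P Q = (A₁ P ∩ A₁ Q) ∪ (A₂ P ∩ A₂ Q)

alignedDist+shared≡2k : (P Q : KPair n k) → alignedDist P Q + shared P Q ≡ 2 * k
alignedDist+shared≡2k {k = k} P Q = begin
  alignedDist P Q + shared P Q
    ≡⟨ interchange (diff (A₁ P) (A₁ Q)) (diff (A₂ P) (A₂ Q)) ∣ A₁ P ∩ A₁ Q ∣ ∣ A₂ P ∩ A₂ Q ∣ ⟩
  (diff (A₁ P) (A₁ Q) + ∣ A₁ P ∩ A₁ Q ∣) + (diff (A₂ P) (A₂ Q) + ∣ A₂ P ∩ A₂ Q ∣)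
    ≡⟨ cong₂ _+_ (trans (∣p∩∁q∣+∣p∩q∣≡∣p∣ (A₁ P) (A₁ Q)) (size₁ P))
                 (trans (∣p∩∁q∣+∣p∩q∣≡∣p∣ (A₂ P) (A₂ Q)) (size₂ P)) ⟩
  k + k
    ≡⟨ cong (k +_) (+-identityʳ k) ⟨
  2 * k ∎
  where open ≡-Reasoning

module _ {d s c : ℕ} (d+s≡c : d + s ≡ c) where

  ≤1⇒∸1≤ : s ≤ 1 → c ∸ 1 ≤ d
  ≤1⇒∸1≤ s≤1 = subst (c ∸ 1 ≤_) (trans (cong (_∸ s) (sym d+s≡c)) (m+n∸n≡m d s)) (∸-monoʳ-≤ c s≤1)

  ∸1≤⇒≤1 : c ∸ 1 ≤ d → s ≤ 1
  ∸1≤⇒≤1 c∸1≤d = +-cancelˡ-≤ d s 1 (begin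
    d + s        ≡⟨ d+s≡c ⟩
    c            ≤⟨ m≤n+m∸n c 1 ⟩
    1 + (c ∸ 1)  ≤⟨ +-monoʳ-≤ 1 c∸1≤d ⟩
    1 + d        ≡⟨ +-comm 1 d ⟩
    d + 1        ∎)
    where open ≤-Reasoning

shared≤1 : (P Q : KPair n k) → (∀ {z z′} → z ∈ common P Q → z′ ∈ common P Q → z ≡ z′) →
            shared P Q ≤ 1
shared≤1 P Q unique = subst (_≤ 1)
  (∣p∪q∣≡∣p∣+∣q∣ (A₁ P ∩ A₁ Q) (A₂ P ∩ A₂ Q) λ z∈A₁ z∈A₂ →
    disj P _ (proj₁ (x∈p∩q⁻ _ _ z∈A₁)) (proj₁ (x∈p∩q⁻ _ _ z∈A₂)))
  (atMostOne⇒∣p∣≤1 unique)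

sharedPair⇒2≤shared : (P Q : KPair n k) {x y : Fin n} →
                       x ∈ A₁ P → x ∈ A₁ Q → y ∈ A₂ P → y ∈ A₂ Q → 2 ≤ shared P Q
sharedPair⇒2≤shared P Q x∈P x∈Q y∈P y∈Q =
  +-mono-≤ (x∈p⇒1≤∣p∣ (x∈p∩q⁺ (x∈P , x∈Q))) (x∈p⇒1≤∣p∣ (x∈p∩q⁺ (y∈P , y∈Q)))

Separated : KPair n k → KPair n k → Set
Separated P Q = shared P Q ≤ 1 × shared P (swap Q) ≤ 1

separated⇒distance : (P Q : KPair n k) → Separated P Q → 2 * k ∸ 1 ≤ dist P Q
separated⇒distance P Q (aligned , crossed) = ⊓-glb
  (≤1⇒∸1≤ (alignedDist+shared≡2k P Q) aligned)
  (≤1⇒∸1≤ (alignedDist+shared≡2k P (swap Q)) crossed)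

distance⇒separated : (P Q : KPair n k) → 2 * k ∸ 1 ≤ dist P Q → Separated P Q
distance⇒separated P Q far =
  ∸1≤⇒≤1 (alignedDist+shared≡2k P Q) (≤-trans far (m⊓n≤m _ _)) ,
  ∸1≤⇒≤1 (alignedDist+shared≡2k P (swap Q)) (≤-trans far (m⊓n≤n _ _))

2k≰1 : 1 ≤ k → ¬ 2 * k ≤ 1
2k≰1 1≤k 2k≤1 = 1+n≰n (≤-trans (*-monoʳ-≤ 2 1≤k) 2k≤1)

sameComponents⇒shared≡2k : (P Q : KPair n k) → A₁ P ≡ A₁ Q → A₂ P ≡ A₂ Q → shared P Q ≡ 2 * k
sameComponents⇒shared≡2k {k = k} P Q A₁≡ A₂≡ = begin
  ∣ A₁ P ∩ A₁ Q ∣ + ∣ A₂ P ∩ A₂ Q ∣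
    ≡⟨ cong₂ (λ X Y → ∣ A₁ P ∩ X ∣ + ∣ A₂ P ∩ Y ∣) (sym A₁≡) (sym A₂≡) ⟩
  ∣ A₁ P ∩ A₁ P ∣ + ∣ A₂ P ∩ A₂ P ∣
    ≡⟨ cong₂ _+_ (trans (cong ∣_∣ (∩-idem (A₁ P))) (size₁ P)) (trans (cong ∣_∣ (∩-idem (A₂ P))) (size₂ P)) ⟩
  k + k
    ≡⟨ cong (k +_) (+-identityʳ k) ⟨
  2 * k ∎
  where open ≡-Reasoning

separated⇒distinct : 1 ≤ k → (P Q : KPair n k) → Separated P Q → ¬ SameUnordered P Q
separated⇒distinct 1≤k P Q (aligned , _) (inj₁ (A₁≡ , A₂≡)) =
  2k≰1 1≤k (subst (_≤ 1) (sameComponents⇒shared≡2k P Q A₁≡ A₂≡) aligned)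
separated⇒distinct 1≤k P Q (_ , crossed) (inj₂ (A₁≡ , A₂≡)) =
  2k≰1 1≤k (subst (_≤ 1) (sameComponents⇒shared≡2k P (swap Q) A₁≡ A₂≡) crossed)

module _ {I : Set} (_≟ᵢ_ : DecidableEquality I) (P : I → KPair n k)
         (separated : ∀ {i j} → i ≢ j → shared (P i) (P j) ≤ 1) where
  private
    module E₁ i = Enumeration (enumerationOfSize (A₁ (P i)) (size₁ (P i)))
    module E₂ i = Enumeration (enumerationOfSize (A₂ (P i)) (size₂ (P i)))

  alignedPair : I × Fin k × Fin k → Fin n × Fin (n ∸ 1)
  alignedPair (i , a , b) = punchOutPair (E₁.at i a) (E₂.at i b) λ eq →
    disj (P i) _ (E₁.at-∈ i a) (subst (_∈ A₂ (P i)) (sym eq) (E₂.at-∈ i b))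

  alignedPair-injective : Injective _≡_ _≡_ alignedPair
  alignedPair-injective {i , a , b} {j , a′ , b′} eq with punchOutPair-injective _ _ eq | i ≟ᵢ j
  ... | x≡ , y≡ | yes refl = cong₂ (λ a b → i , a , b) (E₁.at-injective i x≡) (E₂.at-injective i y≡)
  ... | x≡ , y≡ | no i≢j   = ⊥-elim (1+n≰n (≤-trans shared≥2 (separated i≢j)))
    where
    shared≥2 : 2 ≤ shared (P i) (P j)
    shared≥2 = sharedPair⇒2≤shared (P i) (P j) (E₁.at-∈ i a) (subst (_∈ A₁ (P j)) (sym x≡) (E₁.at-∈ j a′))
                                   (E₂.at-∈ i b) (subst (_∈ A₂ (P j)) (sym y≡) (E₂.at-∈ j b′))

  separatedFamily-bound : ∀ {M} → Fin M ↔ I → M * (k * k) ≤ n * (n ∸ 1)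
  separatedFamily-bound indexing =
    ↣⇒≤ (↔⇒↣ (↔-sym *↔×) ↣-∘ (mk↣ alignedPair-injective ↣-∘ ↔⇒↣ ((indexing ×-↔ *↔×) ↔-∘ *↔×)))

orient : Fin 2 → KPair n k → KPair n k
orient Fin.zero    P = P
orient (Fin.suc _) P = swap P

orient-separated : ∀ o o′ (P Q : KPair n k) → Separated P Q → shared (orient o P) (orient o′ Q) ≤ 1
orient-separated Fin.zero    Fin.zero    P Q = proj₁
orient-separated Fin.zero    (Fin.suc _) P Q = proj₂
orient-separated (Fin.suc _) Fin.zero    P Q (_ , crossed) =
  subst (_≤ 1) (+-comm ∣ A₁ P ∩ A₂ Q ∣ ∣ A₂ P ∩ A₁ Q ∣) crossed
orient-separated (Fin.suc _) (Fin.suc _) P Q (aligned , _) =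
  subst (_≤ 1) (+-comm ∣ A₁ P ∩ A₁ Q ∣ ∣ A₂ P ∩ A₂ Q ∣) aligned

∉common-swap : (P : KPair n k) {z : Fin n} → z ∉ common P (swap P)
∉common-swap P z∈ with x∈p∪q⁻ (A₁ P ∩ A₂ P) _ z∈
... | inj₁ z∈A₁∩A₂ = uncurry (disj P _) (x∈p∩q⁻ _ _ z∈A₁∩A₂)
... | inj₂ z∈A₂∩A₁ = uncurry (λ z∈A₂ z∈A₁ → disj P _ z∈A₁ z∈A₂) (x∈p∩q⁻ _ _ z∈A₂∩A₁)

orient-self : ∀ {o o′} (P : KPair n k) → o ≢ o′ → shared (orient o P) (orient o′ P) ≤ 1
orient-self {o = Fin.zero}         {Fin.zero}         P o≢o′ = ⊥-elim (o≢o′ refl)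
orient-self {o = Fin.suc Fin.zero} {Fin.suc Fin.zero} P o≢o′ = ⊥-elim (o≢o′ refl)
orient-self {o = Fin.zero}         {Fin.suc _}        P _    =
  shared≤1 P (swap P) λ z∈ _ → ⊥-elim (∉common-swap P z∈)
orient-self {o = Fin.suc _}        {Fin.zero}         P _    =
  shared≤1 (swap P) P λ z∈ _ → ⊥-elim (∉common-swap (swap P) z∈)

codeSize-bound : ∀ {M} → Code n k (2 * k ∸ 1) M → M * (2 * k * k) ≤ n * (n ∸ 1)
codeSize-bound {n} {k} {M} C = subst (_≤ n * (n ∸ 1)) (reassociate M k)
  (separatedFamily-bound (≡-dec _≟_ _≟_) oriented separated *↔×)
  where
  open Code C
  reassociate : ∀ M k → M * 2 * (k * k) ≡ M * (2 * k * k)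
  reassociate = solve 2 (λ M k → M :* con 2 :* (k :* k) := M :* (con 2 :* k :* k)) refl
  oriented : Fin M × Fin 2 → KPair n k
  oriented (j , o) = orient o (member j)
  separated : ∀ {x y} → x ≢ y → shared (oriented x) (oriented y) ≤ 1
  separated {j , o} {j′ , o′} x≢y with j ≟ j′
  ... | yes refl = orient-self (member j) λ o≡o′ → x≢y (cong (j ,_) o≡o′)
  ... | no j≢j′  = orient-separated o o′ _ _ (distance⇒separated (member j) (member j′) (minDist j j′ j≢j′))

byOrder : {P : Fin n → Fin n → Set} → (∀ {i j} → P i j → P j i) →
          (∀ {i j} → toℕ i < toℕ j → P i j) → ∀ {i j} → i ≢ j → P i j
byOrder sym-P ordered {i} {j} i≢j with Finₚ.<-cmp i j
... | tri< i<j _ _ = ordered i<j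
... | tri≈ _ i≡j _ = ⊥-elim (i≢j i≡j)
... | tri> _ _ j<i = sym-P (ordered j<i)

module CyclicDifference (m : ℕ) .{{_ : NonZero m}} where

  _⊕_ : Fin m → Fin m → Fin m
  u ⊕ x = (toℕ u + toℕ x) mod m

  _⊖_ : Fin m → Fin m → ℕ
  u ⊖ v = (toℕ u + (m ∸ toℕ v)) % m

  toℕ-⊕ : ∀ u x → toℕ (u ⊕ x) ≡ (toℕ u + toℕ x) % m
  toℕ-⊕ u x = Finₚ.toℕ-fromℕ< (m%n<n (toℕ u + toℕ x) m)

  circular : ℕ → ℕ
  circular r = r ⊓ (m ∸ r)

  circular-reflect : ∀ {d} → d ≤ m → circular (m ∸ d) ≡ circular d
  circular-reflect {d} d≤m = trans (cong ((m ∸ d) ⊓_) (m∸[m∸n]≡n d≤m)) (⊓-comm (m ∸ d) d)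

  ⊖-≥ : ∀ {u v} → toℕ v ≤ toℕ u → u ⊖ v ≡ toℕ u ∸ toℕ v
  ⊖-≥ {u} {v} v≤u = begin
    (a + (m ∸ c)) % m        ≡⟨ cong (λ x → (x + (m ∸ c)) % m) (m∸n+n≡m v≤u) ⟨
    ((a ∸ c) + c + (m ∸ c)) % m ≡⟨ cong (_% m) (+-assoc (a ∸ c) c (m ∸ c)) ⟩
    ((a ∸ c) + (c + (m ∸ c))) % m ≡⟨ cong (λ x → ((a ∸ c) + x) % m) (m+[n∸m]≡n (<⇒≤ (toℕ<n v))) ⟩
    ((a ∸ c) + m) % m        ≡⟨ [m+n]%n≡m%n (a ∸ c) m ⟩
    (a ∸ c) % m              ≡⟨ m<n⇒m%n≡m (≤-<-trans (m∸n≤m a c) (toℕ<n u)) ⟩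
    a ∸ c                    ∎
    where
    open ≡-Reasoning
    a = toℕ u
    c = toℕ v

  ⊖-< : ∀ {u v} → toℕ u < toℕ v → u ⊖ v ≡ m ∸ (toℕ v ∸ toℕ u)
  ⊖-< {u} {v} u<v = begin
    (a + (m ∸ c)) % m          ≡⟨ m<n⇒m%n≡m (subst (a + (m ∸ c) <_) c+[m∸c]≡m (+-monoˡ-< (m ∸ c) u<v)) ⟩
    a + (m ∸ c)                ≡⟨ m+n∸n≡m (a + (m ∸ c)) (c ∸ a) ⟨
    a + (m ∸ c) + (c ∸ a) ∸ (c ∸ a) ≡⟨ cong (_∸ (c ∸ a)) sum≡m ⟩
    m ∸ (c ∸ a)                ∎
    where
    open ≡-Reasoning
    a = toℕ u
    c = toℕ v
    c+[m∸c]≡m : c + (m ∸ c) ≡ m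
    c+[m∸c]≡m = m+[n∸m]≡n (<⇒≤ (toℕ<n v))
    sum≡m : a + (m ∸ c) + (c ∸ a) ≡ m
    sum≡m = begin
      a + (m ∸ c) + (c ∸ a) ≡⟨ solve 3 (λ x y z → x :+ y :+ z := z :+ x :+ y) refl a (m ∸ c) (c ∸ a) ⟩
      (c ∸ a) + a + (m ∸ c) ≡⟨ cong (_+ (m ∸ c)) (m∸n+n≡m (<⇒≤ u<v)) ⟩
      c + (m ∸ c)           ≡⟨ c+[m∸c]≡m ⟩
      m                     ∎

  δF≡circular⊖ : ∀ u v → δF m u v ≡ circular (u ⊖ v)
  δF≡circular⊖ u v with toℕ v ≤? toℕ u
  ... | yes v≤u = trans (cong circular (m≤n⇒∣n-m∣≡n∸m v≤u)) (cong circular (sym (⊖-≥ v≤u)))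
  ... | no  v≰u = begin
    circular ∣ toℕ u - toℕ v ∣   ≡⟨ cong circular (m≤n⇒∣m-n∣≡n∸m (<⇒≤ u<v)) ⟩
    circular (toℕ v ∸ toℕ u)     ≡⟨ circular-reflect (≤-trans (m∸n≤m (toℕ v) (toℕ u)) (<⇒≤ (toℕ<n v))) ⟨
    circular (m ∸ (toℕ v ∸ toℕ u)) ≡⟨ cong circular (⊖-< u<v) ⟨
    circular (u ⊖ v)             ∎
    where
    open ≡-Reasoning
    u<v = ≰⇒> v≰u

  ⊖-self : ∀ u → u ⊖ u ≡ 0
  ⊖-self u = trans (⊖-≥ (≤-refl {toℕ u})) (n∸n≡0 (toℕ u))

  private
    ⊖+⊖≡m-< : ∀ {u v} → toℕ u < toℕ v → u ⊖ v + v ⊖ u ≡ m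
    ⊖+⊖≡m-< {u} {v} u<v = trans (cong₂ _+_ (⊖-< u<v) (⊖-≥ (<⇒≤ u<v)))
      (m∸n+n≡m (≤-trans (m∸n≤m (toℕ v) (toℕ u)) (<⇒≤ (toℕ<n v))))

  ⊖+⊖≡m : ∀ {u v} → u ≢ v → u ⊖ v + v ⊖ u ≡ m
  ⊖+⊖≡m {u} {v} u≢v with Finₚ.<-cmp u v
  ... | tri< u<v _ _ = ⊖+⊖≡m-< u<v
  ... | tri≈ _ u≡v _ = ⊥-elim (u≢v u≡v)
  ... | tri> _ _ v<u = trans (+-comm (u ⊖ v) (v ⊖ u)) (⊖+⊖≡m-< v<u)

  ⊖≡0⇒≡ : ∀ {u v} → u ⊖ v ≡ 0 → u ≡ v
  ⊖≡0⇒≡ {u} {v} u⊖v≡0 with u ≟ v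
  ... | yes u≡v = u≡v
  ... | no  u≢v = ⊥-elim (<-irrefl (trans (cong (_+ v ⊖ u) (sym u⊖v≡0)) (⊖+⊖≡m u≢v))
                                   (m%n<n (toℕ v + (m ∸ toℕ u)) m))

  ⊕-cancel : ∀ {u u′ x y} → u ⊕ x ≡ u′ ⊕ y → u ⊖ u′ ≡ y ⊖ x
  ⊕-cancel {u} {u′} {x} {y} eq = begin
    (a + (m ∸ a′)) % m                      ≡⟨ +complement% (a + (m ∸ a′)) x ⟨
    (a + (m ∸ a′) + (c + (m ∸ c))) % m      ≡⟨ cong (_% m) (interchange a (m ∸ a′) c (m ∸ c)) ⟩
    (a + c + ((m ∸ a′) + (m ∸ c))) % m      ≡⟨ %-+-congˡ (a + c) (a′ + d) sums≡ ⟩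
    (a′ + d + ((m ∸ a′) + (m ∸ c))) % m     ≡⟨ cong (_% m) (interchange a′ d (m ∸ a′) (m ∸ c)) ⟩
    (a′ + (m ∸ a′) + (d + (m ∸ c))) % m     ≡⟨ cong (_% m) (+-comm (a′ + (m ∸ a′)) (d + (m ∸ c))) ⟩
    (d + (m ∸ c) + (a′ + (m ∸ a′))) % m     ≡⟨ +complement% (d + (m ∸ c)) u′ ⟩
    (d + (m ∸ c)) % m                       ∎
    where
    open ≡-Reasoning
    a = toℕ u ; a′ = toℕ u′ ; c = toℕ x ; d = toℕ y
    sums≡ : (a + c) % m ≡ (a′ + d) % m
    sums≡ = trans (sym (toℕ-⊕ u x)) (trans (cong toℕ eq) (toℕ-⊕ u′ y))
    +complement% : ∀ r w → (r + (toℕ w + (m ∸ toℕ w))) % m ≡ r % m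
    +complement% r w = trans (cong (λ z → (r + z) % m) (m+[n∸m]≡n (<⇒≤ (toℕ<n w)))) ([m+n]%n≡m%n r m)
    %-+-congˡ : ∀ p q {r} → p % m ≡ q % m → (p + r) % m ≡ (q + r) % m
    %-+-congˡ p q {r} p≡q = begin
      (p + r) % m           ≡⟨ %-distribˡ-+ p r m ⟩
      (p % m + r % m) % m   ≡⟨ cong (λ z → (z + r % m) % m) p≡q ⟩
      (q % m + r % m) % m   ≡⟨ %-distribˡ-+ q r m ⟨
      (q + r) % m           ∎

  ⊕-injectiveˡ : ∀ {u u′ x} → u ⊕ x ≡ u′ ⊕ x → u ≡ u′
  ⊕-injectiveˡ {u} {u′} {x} eq = ⊖≡0⇒≡ (trans (⊕-cancel {u} {u′} {x} {x} eq) (⊖-self x))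

  ⊖-antisym : (∀ r → r + r ≢ m) → ∀ {u v} → u ≢ v → u ⊖ v ≢ v ⊖ u
  ⊖-antisym odd {u} {v} u≢v eq = odd (u ⊖ v) (trans (cong (u ⊖ v +_) eq) (⊖+⊖≡m u≢v))

  δF-sym : ∀ u v → δF m u v ≡ δF m v u
  δF-sym u v = cong circular (∣-∣-comm (toℕ u) (toℕ v))

  ⊖≡⇒δF≡ : ∀ u v u′ v′ → u ⊖ v ≡ u′ ⊖ v′ → δF m u v ≡ δF m u′ v′
  ⊖≡⇒δF≡ u v u′ v′ eq =
    trans (δF≡circular⊖ u v) (trans (cong circular eq) (sym (δF≡circular⊖ u′ v′)))

  nonzero⇒≢ : ∀ {R u v} → R ≢ 0 → u ⊖ v ≡ R → u ≢ v
  nonzero⇒≢ {u = u} R≢0 u⊖v≡R refl = R≢0 (trans (sym u⊖v≡R) (⊖-self u))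

  SameUnorderedIndices : ∀ {k} → Fin k → Fin k → Fin k → Fin k → Set
  SameUnorderedIndices i j i′ j′ = (i ≡ i′ × j ≡ j′) ⊎ (i ≡ j′ × j ≡ i′)

  DistinctDistances : ∀ {k} → (Fin k → Fin m) → Set
  DistinctDistances f = ∀ i j i′ j′ → toℕ i < toℕ j → toℕ i′ < toℕ j′ →
                        δF m (f i) (f j) ≡ δF m (f i′) (f j′) → (i ≡ i′ × j ≡ j′)

  distinctDistances-unordered : ∀ {k} (f : Fin k → Fin m) → DistinctDistances f →
                                ∀ {i j i′ j′} → i ≢ j → i′ ≢ j′ →
                                δF m (f i) (f j) ≡ δF m (f i′) (f j′) → SameUnorderedIndices i j i′ j′
  distinctDistances-unordered f distinct i≢j i′≢j′ =
    byOrder (λ p eq → flipˡ (p (trans (δF-sym (f _) (f _)) eq)))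
            (λ i<j → byOrder (λ q eq → flipʳ (q (trans eq (δF-sym (f _) (f _)))))
                             (λ i′<j′ → inj₁ ∘ distinct _ _ _ _ i<j i′<j′) i′≢j′)
            i≢j
    where
    flipˡ : ∀ {i j i′ j′} → SameUnorderedIndices i j i′ j′ → SameUnorderedIndices j i i′ j′
    flipˡ (inj₁ (i≡i′ , j≡j′)) = inj₂ (j≡j′ , i≡i′)
    flipˡ (inj₂ (i≡j′ , j≡i′)) = inj₁ (j≡i′ , i≡j′)
    flipʳ : ∀ {i j i′ j′} → SameUnorderedIndices i j j′ i′ → SameUnorderedIndices i j i′ j′
    flipʳ (inj₁ (i≡j′ , j≡i′)) = inj₂ (i≡j′ , j≡i′)
    flipʳ (inj₂ (i≡i′ , j≡j′)) = inj₁ (i≡i′ , j≡j′)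

  sameDifference⇒sameStart : (∀ r → r + r ≢ m) → ∀ {k} (f : Fin k → Fin m) → DistinctDistances f →
                             ∀ {R a a′ c c′} → R ≢ 0 →
                             f a ⊖ f a′ ≡ R → f c ⊖ f c′ ≡ R → f a ≡ f c
  sameDifference⇒sameStart odd f distinct {a = a} {a′} {c} {c′} R≢0 eq eq′
    with distinctDistances-unordered f distinct (nonzero⇒≢ R≢0 eq ∘ cong f) (nonzero⇒≢ R≢0 eq′ ∘ cong f)
           (⊖≡⇒δF≡ (f a) (f a′) (f c) (f c′) (trans eq (sym eq′)))
  ... | inj₁ (refl , _)    = refl
  ... | inj₂ (refl , refl) = ⊥-elim (⊖-antisym odd {f a} {f a′} (nonzero⇒≢ R≢0 eq) (trans eq (sym eq′)))

module Antagonistic {m k : ℕ} .{{_ : NonZero m}} (odd : ∀ r → r + r ≢ m) (A : AntagonisticPair m k) where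
  open CyclicDifference m
  open AntagonisticPair A renaming (disj to s≢t)

  δF-S≢δF-T : ∀ {a a′ c c′} → a ≢ a′ → c ≢ c′ → δF m (s a) (s a′) ≢ δF m (t c) (t c′)
  δF-S≢δF-T a≢a′ c≢c′ =
    byOrder (λ p eq → p (trans (δF-sym (s _) (s _)) eq))
            (λ a<a′ → byOrder (λ q eq → q (trans eq (δF-sym (t _) (t _))))
                              (λ c<c′ → condST _ _ _ _ a<a′ c<c′) c≢c′)
            a≢a′

  data WithinDifference (R : ℕ) : Fin m → Set where
    inS : ∀ {a a′} → s a ⊖ s a′ ≡ R → WithinDifference R (s a)
    inT : ∀ {c c′} → t c ⊖ t c′ ≡ R → WithinDifference R (t c)

  private
    withinS-withinT-impossible : ∀ {R a a′ c c′} → R ≢ 0 → s a ⊖ s a′ ≡ R → t c ⊖ t c′ ≡ R → ⊥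
    withinS-withinT-impossible {a = a} {a′} {c} {c′} R≢0 eq eq′ =
      δF-S≢δF-T (nonzero⇒≢ R≢0 eq ∘ cong s) (nonzero⇒≢ R≢0 eq′ ∘ cong t)
                (⊖≡⇒δF≡ (s a) (s a′) (t c) (t c′) (trans eq (sym eq′)))

  withinDifference-unique : ∀ {R u v} → R ≢ 0 → WithinDifference R u → WithinDifference R v → u ≡ v
  withinDifference-unique R≢0 (inS eq) (inS eq′) = sameDifference⇒sameStart odd s condSS R≢0 eq eq′
  withinDifference-unique R≢0 (inT eq) (inT eq′) = sameDifference⇒sameStart odd t condTT R≢0 eq eq′
  withinDifference-unique R≢0 (inS eq) (inT eq′) = ⊥-elim (withinS-withinT-impossible R≢0 eq eq′)
  withinDifference-unique R≢0 (inT eq) (inS eq′) = ⊥-elim (withinS-withinT-impossible R≢0 eq′ eq)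

  data AcrossDifference (R : ℕ) : Fin m → Set where
    fromS : ∀ {a c} → s a ⊖ t c ≡ R → AcrossDifference R (s a)
    fromT : ∀ {c a} → t c ⊖ s a ≡ R → AcrossDifference R (t c)

  private
    fromS-fromT-impossible : ∀ {R a c c′ a′} → s a ⊖ t c ≡ R → t c′ ⊖ s a′ ≡ R → ⊥
    fromS-fromT-impossible {a = a} {c} {c′} {a′} eq eq′
      with cond2 a c a′ c′
             (trans (⊖≡⇒δF≡ (s a) (t c) (t c′) (s a′) (trans eq (sym eq′))) (δF-sym (t c′) (s a′)))
    ... | refl , refl = ⊖-antisym odd {s a} {t c} (s≢t a c) (trans eq (sym eq′))

  acrossDifference-unique : ∀ {R u v} → AcrossDifference R u → AcrossDifference R v → u ≡ v
  acrossDifference-unique (fromS {a} {c} eq) (fromS {a′} {c′} eq′) =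
    cong s (proj₁ (cond2 a c a′ c′ (⊖≡⇒δF≡ (s a) (t c) (s a′) (t c′) (trans eq (sym eq′)))))
  acrossDifference-unique (fromT {c} {a} eq) (fromT {c′} {a′} eq′) =
    cong t (proj₂ (cond2 a c a′ c′ (begin
      δF m (s a) (t c)    ≡⟨ δF-sym (s a) (t c) ⟩
      δF m (t c) (s a)    ≡⟨ ⊖≡⇒δF≡ (t c) (s a) (t c′) (s a′) (trans eq (sym eq′)) ⟩
      δF m (t c′) (s a′)  ≡⟨ δF-sym (t c′) (s a′) ⟩
      δF m (s a′) (t c′)  ∎)))
    where open ≡-Reasoning
  acrossDifference-unique (fromS eq) (fromT eq′) = ⊥-elim (fromS-fromT-impossible eq eq′)
  acrossDifference-unique (fromT eq) (fromS eq′) = ⊥-elim (fromS-fromT-impossible eq′ eq)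

∈common⇒∈components : (P Q : KPair n k) {z : Fin n} → z ∈ common P Q →
                       (z ∈ A₁ P ⊎ z ∈ A₂ P) × (z ∈ A₁ Q ⊎ z ∈ A₂ Q)
∈common⇒∈components P Q z∈ with x∈p∪q⁻ (A₁ P ∩ A₁ Q) _ z∈
... | inj₁ z∈₁ = inj₁ (proj₁ (x∈p∩q⁻ _ _ z∈₁)) , inj₁ (proj₂ (x∈p∩q⁻ _ _ z∈₁))
... | inj₂ z∈₂ = inj₂ (proj₁ (x∈p∩q⁻ _ _ z∈₂)) , inj₂ (proj₂ (x∈p∩q⁻ _ _ z∈₂))

module SteinerBlocks {n m : ℕ} (S : SteinerSystem n m) where
  open SteinerSystem S public

  private
    module B i = Enumeration (enumerationOfSize (block i) (blockSize i))

  point : Fin b → Fin m → Fin n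
  point = B.at

  point-injective : ∀ i → Injective _≡_ _≡_ (point i)
  point-injective = B.at-injective

  point-∈ : ∀ i p → point i p ∈ block i
  point-∈ = B.at-∈

  position : ∀ {i x} → x ∈ block i → Fin m
  position {i} = B.index i

  point-position : ∀ {i x} (x∈ : x ∈ block i) → point i (position x∈) ≡ x
  point-position {i} = B.at-index i

  blocks-meet-once : ∀ {i i′ z z′} → i ≢ i′ → z ∈ block i → z ∈ block i′ →
                     z′ ∈ block i → z′ ∈ block i′ → z ≡ z′
  blocks-meet-once {i} {i′} {z} {z′} i≢i′ z∈i z∈i′ z′∈i z′∈i′ with z ≟ z′
  ... | yes z≡z′ = z≡z′
  ... | no  z≢z′ with pairUnique z z′ z≢z′
  ... | _ , _ , unique = ⊥-elim (i≢i′ (trans (unique i z∈i z′∈i) (sym (unique i′ z∈i′ z′∈i′))))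

  InBlock : ∀ {k} → Fin b → KPair n k → Set
  InBlock i P = ∀ {z} → z ∈ A₁ P ⊎ z ∈ A₂ P → z ∈ block i

  swap-inBlock : ∀ {k i} (P : KPair n k) → InBlock i P → InBlock i (swap P)
  swap-inBlock P P⊆i z∈ = P⊆i (Sum.swap z∈)

  differentBlocks⇒shared≤1 : ∀ {k i i′} (P Q : KPair n k) → i ≢ i′ → InBlock i P → InBlock i′ Q →
                             shared P Q ≤ 1
  differentBlocks⇒shared≤1 P Q i≢i′ P⊆i Q⊆i′ = shared≤1 P Q λ z∈ z′∈ →
    let (z∈P , z∈Q) = ∈common⇒∈components P Q z∈ ; (z′∈P , z′∈Q) = ∈common⇒∈components P Q z′∈ in
    blocks-meet-once i≢i′ (P⊆i z∈P) (Q⊆i′ z∈Q) (P⊆i z′∈P) (Q⊆i′ z′∈Q)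

steiner-pairCount : ∀ {n m} (S : SteinerSystem n m) → n * (n ∸ 1) ≤ SteinerSystem.b S * (m * (m ∸ 1))
steiner-pairCount {zero}  S = z≤n
steiner-pairCount {suc n} {m} S =
  ↣⇒≤ (↔⇒↣ (↔-sym ((↔-id _ ×-↔ *↔×) ↔-∘ *↔×)) ↣-∘ (mk↣ inBlock-injective ↣-∘ ↔⇒↣ *↔×))
  where
  open SteinerBlocks S
  module Pair (x : Fin (suc n)) (y′ : Fin n) where
    y = punchIn x y′
    x≢y : x ≢ y
    x≢y = Finₚ.punchInᵢ≢i x y′ ∘ sym
    I : Fin b
    I = proj₁ (pairUnique x y x≢y)
    x∈I : x ∈ block I
    x∈I = proj₁ (proj₁ (proj₂ (pairUnique x y x≢y)))
    y∈I : y ∈ block I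
    y∈I = proj₂ (proj₁ (proj₂ (pairUnique x y x≢y)))
    positions≢ : position x∈I ≢ position y∈I
    positions≢ eq = x≢y (trans (sym (point-position x∈I)) (trans (cong (point I) eq) (point-position y∈I)))
  inBlock : Fin (suc n) × Fin n → Fin b × Fin m × Fin (m ∸ 1)
  inBlock (x , y′) = I , punchOutPair (position x∈I) (position y∈I) positions≢
    where open Pair x y′
  inBlock-injective : Injective _≡_ _≡_ inBlock
  inBlock-injective {x , y′} {x′ , y″} eq = cong₂ _,_ x≡x′
    (Finₚ.punchIn-injective x′ y′ y″ (trans (cong (λ w → punchIn w y′) (sym x≡x′)) y≡y′))
    where
    positions≡ = punchOutPair-injective _ _ (cong proj₂ eq)
    pointsAgree : ∀ {z z′} (z∈ : z ∈ block (Pair.I x y′)) (z′∈ : z′ ∈ block (Pair.I x′ y″)) →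
                  position z∈ ≡ position z′∈ → z ≡ z′
    pointsAgree z∈ z′∈ pos≡ =
      trans (sym (point-position z∈)) (trans (cong₂ point (cong proj₁ eq) pos≡) (point-position z′∈))
    x≡x′ = pointsAgree (Pair.x∈I x y′) (Pair.x∈I x′ y″) (proj₁ positions≡)
    y≡y′ = pointsAgree (Pair.y∈I x y′) (Pair.y∈I x′ y″) (proj₂ positions≡)

module SteinerConstruction {n m k : ℕ} .{{_ : NonZero m}} (odd : ∀ r → r + r ≢ m)
                           (S : SteinerSystem n m) (A : AntagonisticPair m k) where
  open CyclicDifference m
  open Antagonistic odd A
  open AntagonisticPair A renaming (disj to s≢t)
  open SteinerBlocks S

  translate : Fin b → Fin m → (Fin k → Fin m) → Fin k → Fin n
  translate i x f a = point i (f a ⊕ x)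

  translate-injective : ∀ i x {f} → Injective _≡_ _≡_ f → Injective _≡_ _≡_ (translate i x f)
  translate-injective i x f-injective = f-injective ∘ ⊕-injectiveˡ ∘ point-injective i

  shiftedPair : Fin b → Fin m → KPair n k
  shiftedPair i x = kpair (image (translate i x s)) (image (translate i x t))
    (∣image∣≡k _ (translate-injective i x (s-inj _ _))) (∣image∣≡k _ (translate-injective i x (t-inj _ _)))
    λ z z∈S z∈T → let (a , Sa≡z) = image-preimage _ z∈S ; (c , Tc≡z) = image-preimage _ z∈T in
      s≢t a c (⊕-injectiveˡ (point-injective i (trans Sa≡z (sym Tc≡z))))

  ∈translate⇒∈block : ∀ i x f {z} → z ∈ image (translate i x f) → z ∈ block i
  ∈translate⇒∈block i x f z∈ = let (a , eq) = image-preimage (translate i x f) z∈ in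
    subst (_∈ block i) eq (point-∈ i (f a ⊕ x))

  shiftedPair-inBlock : ∀ i x → InBlock i (shiftedPair i x)
  shiftedPair-inBlock i x (inj₁ z∈) = ∈translate⇒∈block i x s z∈
  shiftedPair-inBlock i x (inj₂ z∈) = ∈translate⇒∈block i x t z∈

  ∈translate∩translate : ∀ i x y f g {z} → z ∈ image (translate i x f) ∩ image (translate i y g) →
                         ∃ λ a → ∃ λ a′ → z ≡ translate i x f a × f a ⊖ g a′ ≡ y ⊖ x
  ∈translate∩translate i x y f g z∈ with x∈p∩q⁻ _ _ z∈
  ... | z∈f , z∈g with image-preimage _ z∈f | image-preimage _ z∈g
  ... | a , fa≡z | a′ , ga′≡z =
    a , a′ , sym fa≡z , ⊕-cancel {f a} {g a′} {x} {y} (point-injective i (trans fa≡z (sym ga′≡z)))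

  ∈common⇒withinDifference : ∀ i x y {z} → z ∈ common (shiftedPair i x) (shiftedPair i y) →
                             ∃ λ u → WithinDifference (y ⊖ x) u × z ≡ point i (u ⊕ x)
  ∈common⇒withinDifference i x y z∈ with x∈p∪q⁻ _ _ z∈
  ... | inj₁ z∈S = let (a , _ , z≡ , eq) = ∈translate∩translate i x y s s z∈S in s a , inS eq , z≡
  ... | inj₂ z∈T = let (c , _ , z≡ , eq) = ∈translate∩translate i x y t t z∈T in t c , inT eq , z≡

  ∈common⇒acrossDifference : ∀ i x y {z} → z ∈ common (shiftedPair i x) (swap (shiftedPair i y)) →
                             ∃ λ u → AcrossDifference (y ⊖ x) u × z ≡ point i (u ⊕ x)
  ∈common⇒acrossDifference i x y z∈ with x∈p∪q⁻ _ _ z∈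
  ... | inj₁ z∈S = let (a , _ , z≡ , eq) = ∈translate∩translate i x y s t z∈S in s a , fromS eq , z≡
  ... | inj₂ z∈T = let (c , _ , z≡ , eq) = ∈translate∩translate i x y t s z∈T in t c , fromT eq , z≡

  startsDetermine⇒shared≤1 : ∀ {i x} Q (Start : Fin m → Set) → (∀ {u v} → Start u → Start v → u ≡ v) →
                             (∀ {z} → z ∈ common (shiftedPair i x) Q →
                                      ∃ λ u → Start u × z ≡ point i (u ⊕ x)) →
                             shared (shiftedPair i x) Q ≤ 1
  startsDetermine⇒shared≤1 {i} {x} Q Start unique start = shared≤1 (shiftedPair i x) Q λ z∈ z′∈ →
    let (u , Su , z≡) = start z∈ ; (v , Sv , z′≡) = start z′∈ in
    trans z≡ (trans (cong (λ w → point i (w ⊕ x)) (unique Su Sv)) (sym z′≡))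

  shiftedPair-separated : ∀ {i x i′ y} → (i , x) ≢ (i′ , y) → Separated (shiftedPair i x) (shiftedPair i′ y)
  shiftedPair-separated {i} {x} {i′} {y} ix≢i′y with i ≟ i′
  ... | no i≢i′ =
    differentBlocks⇒shared≤1 P Q i≢i′ (shiftedPair-inBlock i x) (shiftedPair-inBlock i′ y) ,
    differentBlocks⇒shared≤1 P (swap Q) i≢i′
      (shiftedPair-inBlock i x) (swap-inBlock Q (shiftedPair-inBlock i′ y))
    where
    P = shiftedPair i x
    Q = shiftedPair i′ y
  ... | yes refl =
    startsDetermine⇒shared≤1 (shiftedPair i y) (WithinDifference (y ⊖ x))
      (withinDifference-unique y⊖x≢0) (∈common⇒withinDifference i x y) ,
    startsDetermine⇒shared≤1 (swap (shiftedPair i y)) (AcrossDifference (y ⊖ x))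
      acrossDifference-unique (∈common⇒acrossDifference i x y)
    where
    y⊖x≢0 : y ⊖ x ≢ 0
    y⊖x≢0 eq = ix≢i′y (cong (i ,_) (sym (⊖≡0⇒≡ eq)))

  code : 1 ≤ k → Code n k (2 * k ∸ 1) (b * m)
  code 1≤k = record
    { member   = member
    ; distinct = λ w w′ w≢w′ → separated⇒distinct 1≤k (member w) (member w′) (separated w≢w′)
    ; minDist  = λ w w′ w≢w′ → separated⇒distance (member w) (member w′) (separated w≢w′)
    }
    where
    member : Fin (b * m) → KPair n k
    member = uncurry shiftedPair ∘ remQuot m
    separated : ∀ {w w′} → w ≢ w′ → Separated (member w) (member w′)
    separated w≢w′ = shiftedPair-separated (w≢w′ ∘ Injection.injective (↔⇒↣ *↔×))

double≢odd : ∀ r q → r + r ≢ q * 2 + 1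
double≢odd r q eq = 0≢1+n (begin
  0                ≡⟨ [m+kn]%n≡m%n 0 r 2 ⟨
  (0 + r * 2) % 2  ≡⟨ cong (_% 2) (trans (solve 1 (λ r → con 0 :+ r :* con 2 := r :+ r) refl r) eq) ⟩
  (q * 2 + 1) % 2  ≡⟨ cong (_% 2) (+-comm (q * 2) 1) ⟩
  (1 + q * 2) % 2  ≡⟨ [m+kn]%n≡m%n 1 q 2 ⟩
  1                ∎)
  where open ≡-Reasoning

corollary7 : (n k : ℕ) → 1 ≤ k → 1 ≤ n →
    SteinerSystem n (2 * k * k + 1) →
    AntagonisticPair (2 * k * k + 1) k →
    ∃[ M ] (IsC n k (2 * k ∸ 1) M × M * (2 * k * k) ≡ n * (n ∸ 1))
corollary7 n k 1≤k _ S A = b * m , (construction , maximal) , size≡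
  where
  h = 2 * k * k
  m = h + 1
  open SteinerSystem S using (b)
  instance
    m-nonZero : NonZero m
    m-nonZero = >-nonZero (m≤n+m 1 h)
  h-nonZero : NonZero h
  h-nonZero = m*n≢0 (2 * k) k {{m*n≢0 2 k {{_}} {{>-nonZero 1≤k}}}} {{>-nonZero 1≤k}}
  odd : ∀ r → r + r ≢ m
  odd r eq = double≢odd r (k * k) (trans eq (cong (_+ 1) h≡k*k*2))
    where
    h≡k*k*2 : h ≡ k * k * 2
    h≡k*k*2 = solve 1 (λ k → con 2 :* k :* k := k :* k :* con 2) refl k
  construction : Code n k (2 * k ∸ 1) (b * m)
  construction = SteinerConstruction.code odd S A 1≤k
  size≡ : b * m * h ≡ n * (n ∸ 1)
  size≡ = ≤-antisym (codeSize-bound construction) (begin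
    n * (n ∸ 1)        ≤⟨ steiner-pairCount S ⟩
    b * (m * (m ∸ 1))  ≡⟨ cong (λ d → b * (m * d)) (m+n∸n≡m h 1) ⟩
    b * (m * h)        ≡⟨ *-assoc b m h ⟨
    b * m * h          ∎)
    where open ≤-Reasoning
  maximal : ∀ M′ → Code n k (2 * k ∸ 1) M′ → M′ ≤ b * m
  maximal M′ C = *-cancelʳ-≤ M′ (b * m) h {{h-nonZero}} (≤-trans (codeSize-bound C) (≤-reflexive (sym size≡)))
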